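{- Let \(G=(V,E)\) be a simple, undirected, connected graph that is not a cactus but such that for every \(e\in E\) the graph \(G-e\) is a cactus. Then for any two edges \(e_1=a_1b_1\) and \(e_2=a_2b_2\) of \(G\), there exists a cycle \(C\) in \(G\) that contains both \(e_1\) and \(e_2\).
   Context: A cactus is a connected graph in which every edge belongs to at most one (simple) cycle; equivalently, a connected graph in which no two distinct cycles share an edge. \(G-e\) denotes the graph \((V,E\setminus\{e\})\). -}

module Defs where

open import Data.Nat using (ℕ; _≤_)
open import Data.Fin using (Fin)
open import Data.List using (List; []; _∷_; _++_; _∷ʳ_; length)
open import Data.List.Relation.Unary.Linked using (Linked)
open import Data.List.Relation.Unary.Unique.Propositional using (Unique)
open import Data.Product using (Σ; ∃; ∃-syntax; _×_; _,_)
open import Data.Sum using (_⊎_; inj₁; inj₂)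
open import Relation.Nullary using (¬_)
open import Relation.Binary.PropositionalEquality using (_≡_)
open import Function.Bundles using (_⇔_)

record Graph (n : ℕ) : Set₁ where
  field
    Adj    : Fin n → Fin n → Set
    sym    : ∀ {u v} → Adj u v → Adj v u
    irrefl : ∀ {u} → ¬ Adj u u
open Graph public

SameEdge : ∀ {n} → Fin n → Fin n → Fin n → Fin n → Set
SameEdge u v a b = (u ≡ a × v ≡ b) ⊎ (u ≡ b × v ≡ a)

deleteEdge : ∀ {n} → Graph n → Fin n → Fin n → Graph n
Adj    (deleteEdge G a b) u v = Adj G u v × ¬ SameEdge u v a b
sym    (deleteEdge G a b) (p , q) =
  sym G p , λ { (inj₁ (x , y)) → q (inj₂ (y , x))
              ; (inj₂ (x , y)) → q (inj₁ (y , x)) }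
irrefl (deleteEdge G a b) (p , _) = irrefl G p

data Reach {n} (G : Graph n) : Fin n → Fin n → Set where
  here : ∀ {u} → Reach G u u
  step : ∀ {u v w} → Adj G u v → Reach G v w → Reach G u w

Connected : ∀ {n} → Graph n → Set
Connected G = ∀ u v → Reach G u v

record Cycle {n} (G : Graph n) : Set where
  field
    first    : Fin n
    rest     : List (Fin n)
    long     : 2 ≤ length rest
    distinct : Unique (first ∷ rest)
    closed   : Linked (Adj G) ((first ∷ rest) ∷ʳ first)
open Cycle public

closedWalk : ∀ {n} {G : Graph n} → Cycle G → List (Fin n)
closedWalk C = (first C ∷ rest C) ∷ʳ first C

HasEdge : ∀ {n} {G : Graph n} → Cycle G → Fin n → Fin n → Set
HasEdge {n} C a b =
  ∃[ xs ] ∃[ ys ] Σ (Fin n) λ u → Σ (Fin n) λ v →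
    (closedWalk C ≡ xs ++ (u ∷ v ∷ ys)) × SameEdge u v a b

-- Cactus: connected, and any two cycles sharing an edge are the same cycle
-- (same edge set), i.e. no two distinct cycles share an edge.
Cactus : ∀ {n} → Graph n → Set
Cactus {n} G =
  Connected G ×
  (∀ (C D : Cycle G) (a b : Fin n) → HasEdge C a b → HasEdge D a b →
     ∀ (x y : Fin n) → HasEdge C x y ⇔ HasEdge D x y)

{-# OPTIONS --safe #-}
module Submission where

-- Deleting an edge leaves G connected, so every edge lies on a cycle; let C₁ ∋ e₁ and C₂ ∋ e₂
-- be cycles, and assume neither contains both edges.  Two facts drive the proof: (i) two cycles
-- that share an edge and both avoid some edge f have the same edges, since both live in the
-- cactus G − f; (ii) a cycle whose edges all lie on another cycle has exactly its edges (cut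
-- the larger one open at a missing edge: a simple path cannot carry a cycle).
-- If C₁ and C₂ share no edge, G would be a cactus: for cycles C, D sharing an edge and h on C
-- but not on D, (i) puts every edge of G on C or D, (ii) then makes every cycle meet D, and (i)
-- again makes every cycle contain h or all of D, so C₁ and C₂ would share an edge.
-- If they share an edge st, walk from b₁ to a₁ around C₁, replacing st by the rest of C₂; this
-- avoids st and e₁, so it closes a cycle Z through e₁ avoiding st.  Were e₂ not on Z, then Z and
-- C₁ would have the same edges by (i) with f = e₂, yet st lies on C₁ only.

open import Defs
open import Data.Nat using (ℕ; _≤_; z≤n; s≤s)
open import Data.Fin using (Fin; _≟_)
open import Data.Fin.Properties using (any?)
open import Data.Product using (Σ; ∃; ∃₂; _×_; _,_; proj₁; proj₂)
open import Data.Sum using (_⊎_; inj₁; inj₂; map₁)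
open import Data.Empty using (⊥-elim)
open import Function using (id; _∘_)
open import Function.Bundles using (mk⇔; Equivalence)
open import Relation.Nullary using (¬_; Dec; yes; no; contradiction)
open import Relation.Nullary.Decidable using (_×-dec_; _⊎-dec_)
open import Relation.Binary.PropositionalEquality as ≡
  using (_≡_; _≢_; refl; trans; cong; subst; setoid)
open import Data.List using (List; []; _∷_; _++_; _∷ʳ_; [_]; length)
open import Data.List.Properties using (++-assoc; ∷-injectiveʳ; length-++-comm)
open import Data.List.Membership.Propositional using (_∈_; _∉_)
open import Data.List.Membership.Propositional.Properties using (∈-++⁺ʳ; ∈-++⁻; ∈-∃++)
open import Data.List.Relation.Unary.Any using (here; there)
import Data.List.Relation.Unary.Any as Any
open import Data.List.Relation.Unary.All.Properties using (¬Any⇒All¬)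
open import Data.List.Relation.Unary.AllPairs using ([]; _∷_)
open import Data.List.Relation.Unary.Linked using (Linked; []; [-]; _∷_)
import Data.List.Relation.Unary.Linked as Linked
open import Data.List.Relation.Unary.Unique.Propositional using (Unique)
open import Data.List.Relation.Unary.Unique.Propositional.Properties using (Unique[x∷xs]⇒x∉xs)
import Data.List.Relation.Binary.Permutation.Setoid.Properties as Permutation

private variable
  A : Set
  R : A → A → Set
  x y z u v : A
  xs ys : List A
  n : ℕ
  G H : Graph n
  a b c d s t p q : Fin n
  W : List (Fin n)

data Consecutive {A : Set} (x y : A) : List A → Set where
  here  : Consecutive x y (x ∷ y ∷ xs)
  there : Consecutive x y xs → Consecutive x y (z ∷ xs)

consecutive-++⁺ˡ : Consecutive u v xs → Consecutive u v (xs ++ ys)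
consecutive-++⁺ˡ here      = here
consecutive-++⁺ˡ (there q) = there (consecutive-++⁺ˡ q)

consecutive-++⁺ʳ : ∀ xs → Consecutive u v ys → Consecutive u v (xs ++ ys)
consecutive-++⁺ʳ []       q = q
consecutive-++⁺ʳ (_ ∷ xs) q = there (consecutive-++⁺ʳ xs q)

consecutive⇒∈ : Consecutive u v xs → u ∈ xs × v ∈ xs
consecutive⇒∈ here      = here refl , there (here refl)
consecutive⇒∈ (there q) with u∈ , v∈ ← consecutive⇒∈ q = there u∈ , there v∈

consecutive-∃++ : Consecutive u v xs → ∃₂ λ ys zs → xs ≡ ys ++ u ∷ v ∷ zs
consecutive-∃++ here = [] , _ , refl
consecutive-∃++ (there {z = z} q) with ys , zs , refl ← consecutive-∃++ q = z ∷ ys , zs , refl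

consecutive-∷ʳ : ∀ xs → Consecutive x y ((xs ∷ʳ x) ∷ʳ y)
consecutive-∷ʳ []       = here
consecutive-∷ʳ (_ ∷ xs) = there (consecutive-∷ʳ xs)

consecutive-∷ʳ⁻ : ∀ xs → Consecutive u v ((xs ∷ʳ x) ∷ʳ y) →
                  Consecutive u v (xs ∷ʳ x) ⊎ (u ≡ x × v ≡ y)
consecutive-∷ʳ⁻ []          here               = inj₂ (refl , refl)
consecutive-∷ʳ⁻ []          (there (there ()))
consecutive-∷ʳ⁻ (_ ∷ [])    here               = inj₁ here
consecutive-∷ʳ⁻ (_ ∷ _ ∷ _) here               = inj₁ here
consecutive-∷ʳ⁻ (_ ∷ xs)    (there q)          = map₁ there (consecutive-∷ʳ⁻ xs q)

∈⇒predecessor : u ∈ xs → ∃ λ z → Consecutive z u (x ∷ xs)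
∈⇒predecessor (here refl) = _ , here
∈⇒predecessor (there u∈)  with z , q ← ∈⇒predecessor u∈ = z , there q

linked-consecutive : Linked R xs → Consecutive u v xs → R u v
linked-consecutive (r ∷ _)  here      = r
linked-consecutive (_ ∷ rs) (there q) = linked-consecutive rs q

consecutive⇒linked : ∀ xs → (∀ {u v} → Consecutive u v xs → R u v) → Linked R xs
consecutive⇒linked []           _ = []
consecutive⇒linked (_ ∷ [])     _ = [-]
consecutive⇒linked (_ ∷ _ ∷ xs) r = r here ∷ consecutive⇒linked (_ ∷ xs) (r ∘ there)

linked-++⁻ʳ : ∀ xs → Linked R (xs ++ ys) → Linked R ys
linked-++⁻ʳ []           rs       = rs
linked-++⁻ʳ (_ ∷ [])     [-]      = []
linked-++⁻ʳ (_ ∷ [])     (_ ∷ rs) = rs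
linked-++⁻ʳ (_ ∷ _ ∷ xs) (_ ∷ rs) = linked-++⁻ʳ (_ ∷ xs) rs

unique-swap : ∀ (xs ys : List A) → Unique (xs ++ ys) → Unique (ys ++ xs)
unique-swap {A} xs ys = Unique-resp-↭ (++-comm xs ys)
  where open Permutation (setoid A)

unique-++⁻ʳ : ∀ xs → Unique (xs ++ ys) → Unique ys
unique-++⁻ʳ []       u       = u
unique-++⁻ʳ (_ ∷ xs) (_ ∷ u) = unique-++⁻ʳ xs u

unique-∷ : x ∉ xs → Unique xs → Unique (x ∷ xs)
unique-∷ x∉ u = ¬Any⇒All¬ _ x∉ ∷ u

unique-head-no-predecessor : Unique (x ∷ xs) → ¬ Consecutive u x (x ∷ xs)
unique-head-no-predecessor u here      = Unique[x∷xs]⇒x∉xs u (here refl)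
unique-head-no-predecessor u (there q) = Unique[x∷xs]⇒x∉xs u (proj₂ (consecutive⇒∈ q))

unique-head-successor : Unique (x ∷ y ∷ xs) → Consecutive x v (x ∷ y ∷ xs) → v ≡ y
unique-head-successor _ here      = refl
unique-head-successor u (there q) = contradiction (proj₁ (consecutive⇒∈ q)) (Unique[x∷xs]⇒x∉xs u)

unique-last≢second : ∀ {s t m : A} M → Unique (t ∷ m ∷ M ∷ʳ s) → s ≢ m
unique-last≢second M (_ ∷ U) refl = Unique[x∷xs]⇒x∉xs U (∈-++⁺ʳ M (here refl))

unique-last-no-successor : ∀ xs → Unique (xs ∷ʳ y) → ¬ Consecutive y v (xs ∷ʳ y)
unique-last-no-successor []               _       (there ())
unique-last-no-successor (_ ∷ [])         u       here      = Unique[x∷xs]⇒x∉xs u (here refl)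
unique-last-no-successor (_ ∷ xs@(_ ∷ _)) u       here      = Unique[x∷xs]⇒x∉xs u (∈-++⁺ʳ xs (here refl))
unique-last-no-successor (_ ∷ xs)         (_ ∷ u) (there q) = unique-last-no-successor xs u q

-- Edges of walks and cycles

sameEdge-refl : SameEdge u v u v
sameEdge-refl = inj₁ (refl , refl)

sameEdge-swap : SameEdge u v v u
sameEdge-swap = inj₂ (refl , refl)

sameEdge-sym : SameEdge u v a b → SameEdge a b u v
sameEdge-sym (inj₁ (refl , refl)) = sameEdge-refl
sameEdge-sym (inj₂ (refl , refl)) = sameEdge-swap

sameEdge-trans : SameEdge u v a b → SameEdge a b c d → SameEdge u v c d
sameEdge-trans (inj₁ (refl , refl)) e                    = e
sameEdge-trans (inj₂ (refl , refl)) (inj₁ (refl , refl)) = sameEdge-swap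
sameEdge-trans (inj₂ (refl , refl)) (inj₂ (refl , refl)) = sameEdge-refl

sameEdge? : (u v a b : Fin n) → Dec (SameEdge u v a b)
sameEdge? u v a b = ((u ≟ a) ×-dec (v ≟ b)) ⊎-dec ((u ≟ b) ×-dec (v ≟ a))

OnWalk : List (Fin n) → Fin n → Fin n → Set
OnWalk W a b = ∃₂ λ u v → Consecutive u v W × SameEdge u v a b

onWalk? : (W : List (Fin n)) (a b : Fin n) → Dec (OnWalk W a b)
onWalk? []           a b = no λ { (_ , _ , () , _) }
onWalk? (_ ∷ [])     a b = no λ { (_ , _ , there () , _) }
onWalk? (u ∷ v ∷ W) a b with sameEdge? u v a b | onWalk? (v ∷ W) a b
... | yes e  | _                   = yes (u , v , here , e)
... | no _   | yes (x , y , q , e) = yes (x , y , there q , e)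
... | no ¬e  | no ¬w               = no λ { (_ , _ , here , e)    → ¬e e
                                          ; (x , y , there q , e) → ¬w (x , y , q , e) }

onWalk-resp : OnWalk W a b → SameEdge a b c d → OnWalk W c d
onWalk-resp (u , v , q , e) e′ = u , v , q , sameEdge-trans e e′

onWalk⇒∈ : OnWalk W a b → a ∈ W × b ∈ W
onWalk⇒∈ (u , v , q , inj₁ (refl , refl)) = consecutive⇒∈ q
onWalk⇒∈ (u , v , q , inj₂ (refl , refl)) with u∈ , v∈ ← consecutive⇒∈ q = v∈ , u∈

onWalk-∷⁻ : OnWalk (p ∷ W) a b → p ≢ a → p ≢ b → OnWalk W a b
onWalk-∷⁻ (_ , _ , here , inj₁ (refl , _)) p≢a _ = contradiction refl p≢a
onWalk-∷⁻ (_ , _ , here , inj₂ (refl , _)) _ p≢b = contradiction refl p≢b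
onWalk-∷⁻ (u , v , there q , e)            _ _   = u , v , q , e

unique-head-onWalk : Unique (p ∷ q ∷ W) → OnWalk (p ∷ q ∷ W) p a → a ≡ q
unique-head-onWalk u (_ , _ , c , inj₁ (refl , refl)) = unique-head-successor u c
unique-head-onWalk u (_ , _ , c , inj₂ (refl , refl)) = contradiction c (unique-head-no-predecessor u)

unique-head-neighbour : Unique (p ∷ W) → OnWalk (p ∷ W) p a → OnWalk (p ∷ W) p b → a ≡ b
unique-head-neighbour {W = []}    _ (_ , _ , there () , _)
unique-head-neighbour {W = _ ∷ _} u pa pb =
  trans (unique-head-onWalk u pa) (≡.sym (unique-head-onWalk u pb))

OnCycle : {G : Graph n} → Cycle G → Fin n → Fin n → Set
OnCycle C = OnWalk (closedWalk C)

_⊆ᵉ_ : Cycle G → Cycle G → Set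
C ⊆ᵉ D = ∀ {x y} → OnCycle C x y → OnCycle D x y

Meets : Cycle G → Cycle G → Set
Meets C D = ∃₂ λ x y → OnCycle C x y × OnCycle D x y

meets? : (C D : Cycle G) → Dec (Meets C D)
meets? C D = any? λ x → any? λ y → onWalk? (closedWalk C) x y ×-dec onWalk? (closedWalk D) x y

onCycle⇒hasEdge : (C : Cycle G) → OnCycle C a b → HasEdge C a b
onCycle⇒hasEdge _ (u , v , q , e) with xs , ys , eq ← consecutive-∃++ q = xs , ys , u , v , eq , e

hasEdge⇒onCycle : (C : Cycle G) → HasEdge C a b → OnCycle C a b
hasEdge⇒onCycle _ (xs , _ , u , v , eq , e) = u , v , subst (Consecutive u v) (≡.sym eq) (consecutive-++⁺ʳ xs here) , e

onCycle⇒hasEdge² : Σ (Cycle G) (λ C → OnCycle C a b × OnCycle C c d) →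
                   Σ (Cycle G) (λ C → HasEdge C a b × HasEdge C c d)
onCycle⇒hasEdge² (C , ab∈C , cd∈C) = C , onCycle⇒hasEdge C ab∈C , onCycle⇒hasEdge C cd∈C

onCycle⇒adj : (C : Cycle G) → OnCycle C a b → Adj G a b
onCycle⇒adj C (_ , _ , q , inj₁ (refl , refl)) = linked-consecutive (closed C) q
onCycle⇒adj {G = G} C (_ , _ , q , inj₂ (refl , refl)) = sym G (linked-consecutive (closed C) q)

∈⇒predecessor-on-cycle : (C : Cycle G) → p ∈ closedWalk C → ∃ λ z → Consecutive z p (closedWalk C)
∈⇒predecessor-on-cycle C (here refl) = ∈⇒predecessor (∈-++⁺ʳ (rest C) (here refl))
∈⇒predecessor-on-cycle C (there p∈)  = ∈⇒predecessor p∈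

-- Cycles cut open at an edge

-- Splitting off m makes the path have at least three vertices, so it cannot use the edge {s , t}.
record Cut {A : Set} (W : List A) (s t : A) : Set where
  field
    m      : A
    M      : List A
    unique : Unique (t ∷ m ∷ M ∷ʳ s)
    ⊆walk  : Consecutive u v (t ∷ m ∷ M ∷ʳ s) → Consecutive u v W
    walk⊆  : Consecutive u v W → (u ≡ s × v ≡ t) ⊎ Consecutive u v (t ∷ m ∷ M ∷ʳ s)

rotate⁺ : Consecutive u v ((x ∷ y ∷ xs) ∷ʳ x) → Consecutive u v (((y ∷ xs) ∷ʳ x) ∷ʳ y)
rotate⁺ {xs = xs} here = consecutive-∷ʳ (_ ∷ xs)
rotate⁺ (there q)      = consecutive-++⁺ˡ q

rotate⁻ : Consecutive u v (((y ∷ xs) ∷ʳ x) ∷ʳ y) → Consecutive u v ((x ∷ y ∷ xs) ∷ʳ x)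
rotate⁻ {xs = xs} q with consecutive-∷ʳ⁻ (_ ∷ xs) q
... | inj₁ q′             = there q′
... | inj₂ (refl , refl)  = here

cut-rotate : {s t : A} → Cut (((y ∷ xs) ∷ʳ x) ∷ʳ y) s t → Cut ((x ∷ y ∷ xs) ∷ʳ x) s t
cut-rotate c = record { Cut c ; ⊆walk = rotate⁻ ∘ ⊆walk ; walk⊆ = walk⊆ ∘ rotate⁺ }
  where open Cut c

-- Rotate the cycle one vertex at a time until (s , t) is its first pair.
cut : ∀ {s t : A} Z {f xs zs} → Unique (f ∷ xs) → 2 ≤ length xs → (f ∷ xs) ∷ʳ f ≡ Z ++ s ∷ t ∷ zs →
      Cut ((f ∷ xs) ∷ʳ f) s t
cut _ {xs = []}     _ ()       _
cut _ {xs = _ ∷ []} _ (s≤s ()) _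
cut [] {f} {xs = _ ∷ m ∷ M} u _ refl = record
  { m = m ; M = M ; unique = unique-swap [ f ] (_ ∷ m ∷ M) u
  ; ⊆walk = there
  ; walk⊆ = λ { here → inj₁ (refl , refl) ; (there q) → inj₂ q } }
cut {s = s} {t} (_ ∷ Z) {f} {r ∷ xs@(_ ∷ _)} {zs} u long eq =
  cut-rotate {xs = xs} (cut Z (unique-swap [ f ] (r ∷ xs) u) long′ eq′)
  where
  long′ : 2 ≤ length (xs ∷ʳ f)
  long′ = subst (2 ≤_) (≡.sym (length-++-comm xs [ f ])) long
  eq′ : ((r ∷ xs) ∷ʳ f) ∷ʳ r ≡ Z ++ s ∷ t ∷ (zs ∷ʳ r)
  eq′ = trans (cong (_∷ʳ r) (∷-injectiveʳ eq)) (++-assoc Z (s ∷ t ∷ zs) [ r ])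

cutAt : {G : Graph n} (C : Cycle G) → Consecutive s t (closedWalk C) → Cut (closedWalk C) s t
cutAt C q with Z , _ , eq ← consecutive-∃++ q = cut Z (distinct C) (long C) eq

unique-path-avoids-ends : ∀ {m : Fin n} M → Unique (t ∷ m ∷ M ∷ʳ s) →
                          Consecutive u v (t ∷ m ∷ M ∷ʳ s) → ¬ SameEdge u v s t
unique-path-avoids-ends M U q (inj₁ (refl , refl)) = unique-last-no-successor (_ ∷ _ ∷ M) U q
unique-path-avoids-ends M U q (inj₂ (refl , refl)) = unique-last≢second M U (unique-head-successor U q)

neighbours : {G : Graph n} (C : Cycle G) → p ∈ closedWalk C →
             ∃₂ λ z₁ z₂ → z₁ ≢ z₂ × OnCycle C p z₁ × OnCycle C p z₂
neighbours C p∈ with _ , qp ← ∈⇒predecessor-on-cycle C p∈ =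
  _ , m , unique-last≢second M unique , (_ , _ , qp , sameEdge-swap) , (_ , _ , ⊆walk here , sameEdge-refl)
  where open Cut (cutAt C qp)

¬cycle-on-path : {G : Graph n} (C : Cycle G) {π : List (Fin n)} → Unique π →
                 ¬ (∀ {x y} → OnCycle C x y → OnWalk π x y)
¬cycle-on-path C {[]} _ C⊆π with _ , _ , _ , e , _ ← neighbours C (here refl)
  with () ← C⊆π e
¬cycle-on-path C {p ∷ π} U@(_ ∷ U′) C⊆π with Any.any? (p ≟_) (closedWalk C)
... | yes p∈C with _ , _ , z₁≢z₂ , e₁ , e₂ ← neighbours C p∈C =
  z₁≢z₂ (unique-head-neighbour U (C⊆π e₁) (C⊆π e₂))
... | no p∉C = ¬cycle-on-path C U′ λ e →
  onWalk-∷⁻ (C⊆π e) (λ { refl → p∉C (proj₁ (onWalk⇒∈ e)) }) (λ { refl → p∉C (proj₂ (onWalk⇒∈ e)) })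

⊆ᵉ⇒⊇ᵉ : {G : Graph n} (C D : Cycle G) → C ⊆ᵉ D → D ⊆ᵉ C
⊆ᵉ⇒⊇ᵉ C D C⊆D {x} {y} (_ , _ , st , e) with onWalk? (closedWalk C) x y
... | yes xy∈C = xy∈C
... | no xy∉C = ⊥-elim (¬cycle-on-path C unique C⊆path)
  where
  open Cut (cutAt D st)
  C⊆path : ∀ {u v} → OnCycle C u v → OnWalk (_ ∷ m ∷ M ∷ʳ _) u v
  C⊆path uv∈C with _ , _ , q , e′ ← C⊆D uv∈C with walk⊆ q
  ... | inj₁ (refl , refl) = contradiction (onWalk-resp uv∈C (sameEdge-trans (sameEdge-sym e′) e)) xy∉C
  ... | inj₂ q′            = _ , _ , q′ , e′

-- Walks, paths and the cycles they close

reach-trans : Reach H a b → Reach H b c → Reach H a c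
reach-trans here       r = r
reach-trans (step e r) r′ = step e (reach-trans r r′)

reach-sym : Reach H a b → Reach H b a
reach-sym here = here
reach-sym {H = H} (step e r) = reach-trans (reach-sym r) (step (sym H e) here)

reach-sameEdge : SameEdge a b c d → Reach H a b → Reach H c d
reach-sameEdge (inj₁ (refl , refl)) = id
reach-sameEdge (inj₂ (refl , refl)) = reach-sym

reach-along : ∀ xs → (∀ {u v} → Consecutive u v ((a ∷ xs) ∷ʳ b) → Reach H u v) → Reach H a b
reach-along []       r = r here
reach-along (_ ∷ xs) r = reach-trans (r here) (reach-along xs (r ∘ there))

record Path (H : Graph n) (a b : Fin n) : Set where
  constructor path
  field
    inner  : List (Fin n)
    unique : Unique (a ∷ inner ∷ʳ b)
    linked : Linked (Adj H) (a ∷ inner ∷ʳ b)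

shortcut : Reach H a b → a ≡ b ⊎ Path H a b
shortcut here = inj₁ refl
shortcut {b = b} (step {u} e r) with shortcut r
... | inj₁ refl with u ≟ b
...   | yes refl = inj₁ refl
...   | no u≢b   = inj₂ (path [] (unique-∷ (λ { (here u≡b) → u≢b u≡b }) (unique-∷ (λ ()) [])) (e ∷ [-]))
shortcut {b = b} (step {u} e r) | inj₂ (path inner U L) with Any.any? (u ≟_) (_ ∷ inner)
... | yes u∈ with Z , Q , eq ← ∈-∃++ u∈ =
  inj₂ (path Q (unique-++⁻ʳ Z (subst Unique eq′ U)) (linked-++⁻ʳ Z (subst (Linked _) eq′ L)))
  where
  eq′ : (_ ∷ inner) ∷ʳ b ≡ Z ++ u ∷ Q ∷ʳ b
  eq′ = trans (cong (_∷ʳ b) eq) (++-assoc Z (u ∷ Q) [ b ])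
... | no u∉ with u ≟ b
...   | yes refl = inj₁ refl
...   | no u≢b   = inj₂ (path (_ ∷ inner) (unique-∷ u∉walk U) (e ∷ L))
  where
  u∉walk : u ∉ (_ ∷ inner) ∷ʳ b
  u∉walk u∈ with ∈-++⁻ (_ ∷ inner) u∈
  ... | inj₁ u∈′        = u∉ u∈′
  ... | inj₂ (here u≡b) = u≢b u≡b

cycle-through : Adj G a b → Reach (deleteEdge G a b) b a → Σ (Cycle G) λ C → OnCycle C a b
cycle-through {G = G} ab r with shortcut r
... | inj₁ refl = ⊥-elim (irrefl G ab)
... | inj₂ (path [] _ ((_ , ba∉) ∷ _)) = ⊥-elim (ba∉ sameEdge-swap)
... | inj₂ (path (m ∷ M) U L) = C , _ , _ , here , sameEdge-refl
  where
  C : Cycle G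
  C = record { first    = _
             ; rest     = _ ∷ m ∷ M
             ; long     = s≤s (s≤s z≤n)
             ; distinct = unique-swap (_ ∷ m ∷ M) [ _ ] U
             ; closed   = ab ∷ Linked.map proj₁ L }

cycle-avoiding : (C : Cycle G) → ¬ OnCycle C a b → Cycle (deleteEdge G a b)
cycle-avoiding C ab∉C = record
  { Cycle C
  ; closed = consecutive⇒linked (closedWalk C) λ q →
      linked-consecutive (closed C) q , λ e → ab∉C (_ , _ , q , e) }

cycle-lift : Cycle (deleteEdge G a b) → Cycle G
cycle-lift C = record { Cycle C ; closed = Linked.map proj₁ (closed C) }

cycle-lift-avoids : (C : Cycle (deleteEdge G a b)) → ¬ OnCycle (cycle-lift C) a b
cycle-lift-avoids C (_ , _ , q , e) = proj₂ (linked-consecutive (closed C) q) e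

detour : {G : Graph n} (C : Cycle G) → OnCycle C s t →
         (∀ {u v} → OnCycle C u v → ¬ SameEdge u v s t → Reach H u v) → Reach H s t
detour C (_ , _ , q , e) reach-edge =
  reach-sameEdge (sameEdge-trans sameEdge-swap e) (reach-along (_ ∷ M) λ q′ →
    reach-edge (_ , _ , ⊆walk q′ , sameEdge-refl)
               (unique-path-avoids-ends M unique q′ ∘ λ e′ → sameEdge-trans e′ (sameEdge-sym e)))
  where open Cut (cutAt C q)

-- Graphs all of whose edge-deleted subgraphs are cacti

cactus-⊆ᵉ : Cactus G → (C D : Cycle G) → OnCycle C a b → OnCycle D a b → C ⊆ᵉ D
cactus-⊆ᵉ (_ , share⇒same) C D ab∈C ab∈D xy∈C =
  hasEdge⇒onCycle D (Equivalence.to (share⇒same C D _ _ (onCycle⇒hasEdge C ab∈C) (onCycle⇒hasEdge D ab∈D) _ _)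
                                    (onCycle⇒hasEdge C xy∈C))

module _ {n} {G : Graph n} (cactus-minus : ∀ a b → Adj G a b → Cactus (deleteEdge G a b)) where

  cycle-through-edge : Adj G a b → Σ (Cycle G) λ C → OnCycle C a b
  cycle-through-edge ab = cycle-through ab (proj₁ (cactus-minus _ _ ab) _ _)

  avoiding-⊆ᵉ : Adj G a b → (C D : Cycle G) → ¬ OnCycle C a b → ¬ OnCycle D a b →
                OnCycle C c d → OnCycle D c d → C ⊆ᵉ D
  avoiding-⊆ᵉ ab C D ab∉C ab∉D =
    cactus-⊆ᵉ (cactus-minus _ _ ab) (cycle-avoiding C ab∉C) (cycle-avoiding D ab∉D)

  -- C and D witness that G is not a cactus.
  module _ (C D : Cycle G) {g₁ g₂ h₁ h₂ : Fin n} (g∈C : OnCycle C g₁ g₂) (g∈D : OnCycle D g₁ g₂)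
           (h∈C : OnCycle C h₁ h₂) (h∉D : ¬ OnCycle D h₁ h₂) where

    edge-covered : Adj G a b → OnCycle C a b ⊎ OnCycle D a b
    edge-covered {a} {b} ab with onWalk? (closedWalk C) a b | onWalk? (closedWalk D) a b
    ... | yes ab∈C | _        = inj₁ ab∈C
    ... | no _     | yes ab∈D = inj₂ ab∈D
    ... | no ab∉C  | no ab∉D  = ⊥-elim (h∉D (avoiding-⊆ᵉ ab C D ab∉C ab∉D g∈C g∈D h∈C))

    meets-D : (X : Cycle G) → Meets X D
    meets-D X with meets? X D
    ... | yes X∩D = X∩D
    ... | no X∩D=∅ = ⊥-elim (X∩D=∅ (_ , _ , ⊆ᵉ⇒⊇ᵉ X C X⊆C g∈C , g∈D))
      where
      X⊆C : X ⊆ᵉ C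
      X⊆C xy∈X with edge-covered (onCycle⇒adj X xy∈X)
      ... | inj₁ xy∈C = xy∈C
      ... | inj₂ xy∈D = ⊥-elim (X∩D=∅ (_ , _ , xy∈X , xy∈D))

    through-h-or-⊇D : (X : Cycle G) → (OnCycle X h₁ h₂ × Meets X D) ⊎ D ⊆ᵉ X
    through-h-or-⊇D X with onWalk? (closedWalk X) h₁ h₂ | meets-D X
    ... | yes h∈X | X∩D                 = inj₁ (h∈X , X∩D)
    ... | no h∉X  | (_ , _ , xy∈X , xy∈D) =
      inj₂ (avoiding-⊆ᵉ (onCycle⇒adj C h∈C) D X h∉D h∉X xy∈D xy∈X)

    cycles-meet : (C₁ C₂ : Cycle G) → Meets C₁ C₂
    cycles-meet C₁ C₂ with through-h-or-⊇D C₁ | through-h-or-⊇D C₂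
    ... | inj₁ (h∈C₁ , _)                  | inj₁ (h∈C₂ , _)                  = _ , _ , h∈C₁ , h∈C₂
    ... | inj₁ (_ , _ , _ , xy∈C₁ , xy∈D)  | inj₂ D⊆C₂                        = _ , _ , xy∈C₁ , D⊆C₂ xy∈D
    ... | inj₂ D⊆C₁                        | inj₁ (_ , _ , _ , xy∈C₂ , xy∈D)  = _ , _ , D⊆C₁ xy∈D , xy∈C₂
    ... | inj₂ D⊆C₁                        | inj₂ D⊆C₂                        = _ , _ , D⊆C₁ g∈D , D⊆C₂ g∈D

  disjoint-cycles⇒cactus : Connected G → (C₁ C₂ : Cycle G) → ¬ Meets C₁ C₂ → Cactus G
  disjoint-cycles⇒cactus connected C₁ C₂ C₁∩C₂=∅ =
    connected , λ C D a b ab∈C ab∈D x y → mk⇔ (share⇒⊆ C D ab∈C ab∈D) (share⇒⊆ D C ab∈D ab∈C)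
    where
    share⇒⊆ : (C D : Cycle G) → HasEdge C a b → HasEdge D a b → HasEdge C x y → HasEdge D x y
    share⇒⊆ C D ab∈C ab∈D xy∈C with onWalk? (closedWalk D) _ _
    ... | yes xy∈D = onCycle⇒hasEdge D xy∈D
    ... | no xy∉D  = ⊥-elim (C₁∩C₂=∅ (cycles-meet C D (hasEdge⇒onCycle C ab∈C) (hasEdge⇒onCycle D ab∈D)
                                                    (hasEdge⇒onCycle C xy∈C) xy∉D C₁ C₂))

  cycle-through-both : {a₁ b₁ a₂ b₂ : Fin n} (C₁ C₂ : Cycle G) →
                       OnCycle C₁ a₁ b₁ → ¬ OnCycle C₁ a₂ b₂ → OnCycle C₂ a₂ b₂ → ¬ OnCycle C₂ a₁ b₁ →
                       Meets C₁ C₂ → Σ (Cycle G) λ C → OnCycle C a₁ b₁ × OnCycle C a₂ b₂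
  cycle-through-both {a₁} {b₁} {a₂} {b₂} C₁ C₂ e₁∈C₁ e₂∉C₁ e₂∈C₂ e₁∉C₂ (s , t , st∈C₁ , st∈C₂) =
    close (cycle-through e₁∈G∖st (reach-sym (detour C₁ e₁∈C₁ reach-C₁-edge)))
    where
    reach-C₁-edge : {u v : Fin n} → OnCycle C₁ u v → ¬ SameEdge u v a₁ b₁ →
                    Reach (deleteEdge (deleteEdge G s t) a₁ b₁) u v
    reach-C₁-edge {u} {v} uv∈C₁ uv≢e₁ with sameEdge? u v s t
    ... | no uv≢st = step ((onCycle⇒adj C₁ uv∈C₁ , uv≢st) , uv≢e₁) here
    ... | yes uv≡st = reach-sameEdge (sameEdge-sym uv≡st) (detour C₂ st∈C₂ λ xy∈C₂ xy≢st →
      step ((onCycle⇒adj C₂ xy∈C₂ , xy≢st) , λ xy≡e₁ → e₁∉C₂ (onWalk-resp xy∈C₂ xy≡e₁)) here)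

    e₁∈G∖st : Adj (deleteEdge G s t) a₁ b₁
    e₁∈G∖st = onCycle⇒adj C₁ e₁∈C₁ , λ e₁≡st → e₁∉C₂ (onWalk-resp st∈C₂ (sameEdge-sym e₁≡st))

    close : Σ (Cycle (deleteEdge G s t)) (λ Z → OnCycle Z a₁ b₁) →
            Σ (Cycle G) λ C → OnCycle C a₁ b₁ × OnCycle C a₂ b₂
    close (Z , e₁∈Z) with onWalk? (closedWalk Z) a₂ b₂
    ... | yes e₂∈Z = cycle-lift Z , e₁∈Z , e₂∈Z
    ... | no e₂∉Z  = ⊥-elim (cycle-lift-avoids Z
      (avoiding-⊆ᵉ (onCycle⇒adj C₂ e₂∈C₂) C₁ (cycle-lift Z) e₂∉C₁ e₂∉Z e₁∈C₁ e₁∈Z st∈C₁))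

theorem4 : (n : ℕ) (G : Graph n) → Connected G → ¬ Cactus G →
    (∀ (a b : Fin n) → Adj G a b → Cactus (deleteEdge G a b)) →
    ∀ (a₁ b₁ a₂ b₂ : Fin n) → Adj G a₁ b₁ → Adj G a₂ b₂ →
    Σ (Cycle G) (λ C → HasEdge C a₁ b₁ × HasEdge C a₂ b₂)
theorem4 n G connected ¬cactus cactus-minus a₁ b₁ a₂ b₂ e₁ e₂
  with C₁ , e₁∈C₁ ← cycle-through-edge cactus-minus e₁
     | C₂ , e₂∈C₂ ← cycle-through-edge cactus-minus e₂
  with onWalk? (closedWalk C₁) a₂ b₂ | onWalk? (closedWalk C₂) a₁ b₁ | meets? C₁ C₂
... | yes e₂∈C₁ | _         | _          = onCycle⇒hasEdge² (C₁ , e₁∈C₁ , e₂∈C₁)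
... | no _      | yes e₁∈C₂ | _          = onCycle⇒hasEdge² (C₂ , e₁∈C₂ , e₂∈C₂)
... | no e₂∉C₁  | no e₁∉C₂  | yes C₁∩C₂  =
  onCycle⇒hasEdge² (cycle-through-both cactus-minus C₁ C₂ e₁∈C₁ e₂∉C₁ e₂∈C₂ e₁∉C₂ C₁∩C₂)
... | no _      | no _      | no C₁∩C₂=∅ =
  ⊥-elim (¬cactus (disjoint-cycles⇒cactus cactus-minus connected C₁ C₂ C₁∩C₂=∅))
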